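{- Let $(P,\le)$ be a finite partially ordered set having a minimum. Then $\chi_P$ is a prime element of the monoid $\mathrm{M}(P)$.
   Context: $\mathrm{M}(P)$ is the monoid under pointwise addition of monotone functions $P\to\mathbb{N}$ ($a\le b\Rightarrow f(a)\le f(b)$); $\chi_P$ is the constant function $1$. An element $a$ is prime if whenever $b+c=a+d$ with $b,c,d\in\mathrm{M}(P)$, one has $b-a\in\mathrm{M}(P)$ or $c-a\in\mathrm{M}(P)$. -}

module Defs where

open import Level using (Level; _⊔_)
open import Data.Nat using (ℕ; _+_)
import Data.Nat
open import Data.Fin using (Fin)
open import Data.Product using (Σ; ∃; _×_; _,_)
import Data.Nat.Properties
open import Data.Sum using (_⊎_)
open import Relation.Binary.Bundles using (Poset)
open import Relation.Binary.PropositionalEquality using (_≡_)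

module _ {c ℓ₁ ℓ₂ : Level} (P : Poset c ℓ₁ ℓ₂) where
  open Poset P

  IsFinite : Set (c ⊔ ℓ₁)
  IsFinite = ∃ λ (n : ℕ) → Σ (Fin n → Carrier) λ e → ∀ x → ∃ λ i → e i ≈ x

  HasMinimum : Set (c ⊔ ℓ₂)
  HasMinimum = Σ Carrier λ m → ∀ x → m ≤ x

  IsMonotone : (Carrier → ℕ) → Set (c ⊔ ℓ₂)
  IsMonotone f = ∀ {a b} → a ≤ b → f a Data.Nat.≤ f b

  M : Set (c ⊔ ℓ₂)
  M = Σ (Carrier → ℕ) IsMonotone

  _⊕_ : M → M → M
  (f , mf) ⊕ (g , mg) =
    (λ x → f x + g x) , (λ p → Data.Nat.Properties.+-mono-≤ (mf p) (mg p))

  _≐_ : M → M → Set c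
  (f , _) ≐ (g , _) = ∀ x → f x ≡ g x

  -- b - a ∈ M(P): there is a monotone g with b = a + g
  DiffIn : M → M → Set (c ⊔ ℓ₂)
  DiffIn b a = ∃ λ (g : M) → b ≐ (a ⊕ g)

  IsPrime : M → Set (c ⊔ ℓ₂)
  IsPrime a = ∀ (b c' d : M) → (b ⊕ c') ≐ (a ⊕ d) → DiffIn b a ⊎ DiffIn c' a

  χ : M
  χ = (λ _ → 1) , (λ _ → Data.Nat.Properties.≤-refl)

-- At the minimum m we have b m + c m = 1 + d m, so b or c is positive at m;
-- by monotonicity it is then positive everywhere, and subtracting χ keeps it
-- monotone.
module Submission where

open import Defs
open import Level using (Level)
open import Relation.Binary.Bundles using (Poset)
open import Data.Nat using (ℕ; zero; suc; _+_; _∸_; _≤_; s≤s; z≤n)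
open import Data.Nat.Properties using (∸-monoˡ-≤; m+[n∸m]≡n; ≤-trans)
open import Data.Product using (_,_; proj₁)
open import Data.Sum using (_⊎_; inj₁; inj₂)
open import Relation.Binary.PropositionalEquality using (_≡_; sym)

sum-suc⇒positive : ∀ {i j k : ℕ} → i + j ≡ suc k → 1 ≤ i ⊎ 1 ≤ j
sum-suc⇒positive {suc _}        _ = inj₁ (s≤s z≤n)
sum-suc⇒positive {zero} {suc _} _ = inj₂ (s≤s z≤n)

module _ {c ℓ₁ ℓ₂ : Level} (P : Poset c ℓ₁ ℓ₂) where
  open Poset P using () renaming (_≤_ to _≤ₚ_)

  ∸-monotone : ∀ {f} k → IsMonotone P f → IsMonotone P (λ x → f x ∸ k)
  ∸-monotone k mono a≤b = ∸-monoˡ-≤ k (mono a≤b)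

  positive⇒diffIn-χ : (b : M P) → (∀ x → 1 ≤ proj₁ b x) → DiffIn P b (χ P)
  positive⇒diffIn-χ (f , mono) pos =
    ((λ x → f x ∸ 1) , ∸-monotone 1 mono) , λ x → sym (m+[n∸m]≡n (pos x))

  positive-at-minimum : ∀ {m} → (∀ x → m ≤ₚ x) → (b : M P) →
                        1 ≤ proj₁ b m → ∀ x → 1 ≤ proj₁ b x
  positive-at-minimum m≤ (_ , mono) pos x = ≤-trans pos (mono (m≤ x))

corollary16 : {c ℓ₁ ℓ₂ : Level} (P : Poset c ℓ₁ ℓ₂) → IsFinite P → HasMinimum P → IsPrime P (χ P)
corollary16 P _ (m , m≤) b c _ b⊕c≐χ⊕d with sum-suc⇒positive (b⊕c≐χ⊕d m)
... | inj₁ b-pos = inj₁ (positive⇒diffIn-χ P b (positive-at-minimum P m≤ b b-pos))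
... | inj₂ c-pos = inj₂ (positive⇒diffIn-χ P c (positive-at-minimum P m≤ c c-pos))
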